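{- Let $k \ge 2$ be an integer. (1) A $k$-oddoid number cannot be written as a sum of $k$ $k$-oddoid numbers. (2) Every integer $x$ with $k \le x \le k(k-1)$ can be written as a sum of $k$ integers, each between $1$ and $k-1$ (inclusive). (3) Let $s$ be a positive integer. Every $k$-evenoid number $y < k^s$ can be written as a sum of $k$ $k$-oddoid numbers, each less than $k^{s-1}$.
   Context: For an integer $k\ge 2$, a positive integer is called $k$-oddoid if its remainder upon division by $k(k-1)$ lies between $1$ and $k-1$ (inclusive); every other positive integer (remainder $0$ or at least $k$) is called $k$-evenoid. -}

module Defs where

open import Data.Nat using (ℕ; zero; suc; _+_; _*_; _∸_; _^_; _≤_; _<_; NonZero)
open import Data.Nat.DivMod using (_%_)
open import Data.Vec using (Vec; sum; toList)
open import Data.List.Relation.Unary.All using (All)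
open import Data.Product using (_×_)
open import Relation.Nullary using (¬_)

Oddoid : (k : ℕ) → .{{NonZero (k * (k ∸ 1))}} → ℕ → Set
Oddoid k n = 0 < n × 1 ≤ n % (k * (k ∸ 1)) × n % (k * (k ∸ 1)) ≤ k ∸ 1

Evenoid : (k : ℕ) → .{{NonZero (k * (k ∸ 1))}} → ℕ → Set
Evenoid k n = 0 < n × ¬ Oddoid k n

AllV : {A : Set} {n : ℕ} → (A → Set) → Vec A n → Set
AllV P v = All P (toList v)

{-# OPTIONS --safe #-}
module Submission where

-- Put M = k(k-1). A number is k-oddoid exactly when it is q M + r with 1 ≤ r ≤ k-1,
-- and a positive number is k-evenoid exactly when it is Q M + R with k ≤ R ≤ M.
-- (1) The residues of k oddoids add up to some R with k ≤ R ≤ k(k-1) = M, so the sum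
-- is evenoid. (2) is the elementary fact that any R with n·lo ≤ R ≤ n·hi splits into
-- n summands from [lo, hi]. (3) Since k^(s-1) ≡ k (mod M), say k^(s-1) = P M + k, the
-- bound y = Q M + R < k^s = (kP + 1) M + k forces Q ≤ kP; splitting Q into k parts
-- q_i ≤ P and R into k parts r_i ∈ [1, k-1] gives oddoid summands q_i M + r_i < k^(s-1).

open import Defs
open import Data.Nat using (ℕ; zero; suc; _+_; _*_; _∸_; _^_; _≤_; _<_; z≤n; s≤s; s≤s⁻¹; _≤?_; NonZero)
open import Data.Nat.Properties
open import Data.Nat.DivMod using (_%_; _/_; %-distribˡ-+; m%n%n≡m%n; [m+kn]%n≡m%n; m<n⇒m%n≡m; n%n≡0; m%n<n; m≡m%n+[m/n]*n)
open import Data.Nat.Tactic.RingSolver using (solve-∀)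
open import Data.Vec using (Vec; sum; map; zipWith; []; _∷_)
open import Data.List.Relation.Unary.All using ([]; _∷_)
import Data.List.Relation.Unary.All as All
open import Data.Product using (_×_; Σ; _,_; proj₁; proj₂)
open import Data.Sum using (inj₁; inj₂)
open import Data.Empty using (⊥-elim)
open import Relation.Nullary using (¬_; yes; no)
open import Relation.Binary.PropositionalEquality using (_≡_; refl; sym; trans; cong; cong₂; subst; module ≡-Reasoning)

AllV-map : {P : ℕ → Set} (f : ℕ → ℕ) {n : ℕ} (v : Vec ℕ n) →
           AllV (λ a → P (f a)) v → AllV P (map f v)
AllV-map f []      []         = []
AllV-map f (x ∷ v) (px ∷ pv) = px ∷ AllV-map f v pv

AllV-zipWith : {P Q R : ℕ → Set} (f : ℕ → ℕ → ℕ) → (∀ {a b} → P a → Q b → R (f a b)) →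
               {n : ℕ} (u v : Vec ℕ n) → AllV P u → AllV Q v → AllV R (zipWith f u v)
AllV-zipWith f pqr []      []      []         []         = []
AllV-zipWith f pqr (x ∷ u) (y ∷ v) (px ∷ pu) (qy ∷ qv) = pqr px qy ∷ AllV-zipWith f pqr u v pu qv

sum-zipWith-*+ : (c : ℕ) {n : ℕ} (u v : Vec ℕ n) →
                 sum (zipWith (λ q r → q * c + r) u v) ≡ sum u * c + sum v
sum-zipWith-*+ c []      []      = refl
sum-zipWith-*+ c (q ∷ u) (r ∷ v) = begin
  q * c + r + sum (zipWith (λ q r → q * c + r) u v) ≡⟨ cong (q * c + r +_) (sum-zipWith-*+ c u v) ⟩
  q * c + r + (sum u * c + sum v)                   ≡⟨ interchange q r (sum u) (sum v) c ⟩
  (q + sum u) * c + (r + sum v)                     ∎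
  where
  open ≡-Reasoning
  interchange : ∀ a b x y c → a * c + b + (x * c + y) ≡ (a + x) * c + (b + y)
  interchange = solve-∀

sum-bounds : {lo hi n : ℕ} (v : Vec ℕ n) → AllV (λ a → lo ≤ a × a ≤ hi) v →
             n * lo ≤ sum v × sum v ≤ n * hi
sum-bounds []      []                = z≤n , z≤n
sum-bounds (x ∷ v) ((lo≤x , x≤hi) ∷ pv) with sum-bounds v pv
... | lower , upper = +-mono-≤ lo≤x lower , +-mono-≤ x≤hi upper

sum-%-map : (d : ℕ) .{{_ : NonZero d}} {n : ℕ} (v : Vec ℕ n) →
            sum v % d ≡ sum (map (_% d) v) % d
sum-%-map d []      = refl
sum-%-map d (x ∷ v) = begin
  (x + sum v) % d                             ≡⟨ %-distribˡ-+ x (sum v) d ⟩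
  (x % d + sum v % d) % d                     ≡⟨ cong (λ s → (x % d + s) % d) (sum-%-map d v) ⟩
  (x % d + sum (map (_% d) v) % d) % d        ≡⟨ cong (λ a → (a + sum (map (_% d) v) % d) % d) (m%n%n≡m%n x d) ⟨
  (x % d % d + sum (map (_% d) v) % d) % d    ≡⟨ %-distribˡ-+ (x % d) (sum (map (_% d) v)) d ⟨
  (x % d + sum (map (_% d) v)) % d            ∎
  where open ≡-Reasoning

split-sum : (n : ℕ) {lo hi R : ℕ} → lo ≤ hi → n * lo ≤ R → R ≤ n * hi →
            Σ (Vec ℕ n) λ v → AllV (λ a → lo ≤ a × a ≤ hi) v × sum v ≡ R
split-sum zero    lo≤hi z≤n   z≤n   = [] , [] , refl
split-sum (suc n) {lo} {hi} {R} lo≤hi lower upper with R ≤? lo + n * hi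
... | yes R≤lo+n*hi =
  let (v , pv , Σv≡) = split-sum n lo≤hi rest-lower (m≤n+o⇒m∸n≤o R lo R≤lo+n*hi)
  in lo ∷ v , (≤-refl , lo≤hi) ∷ pv , trans (cong (lo +_) Σv≡) (m+[n∸m]≡n (m+n≤o⇒m≤o lo lower))
  where
  rest-lower : n * lo ≤ R ∸ lo
  rest-lower = m+n≤o⇒m≤o∸n (n * lo) (subst (_≤ R) (+-comm lo (n * lo)) lower)
... | no R≰lo+n*hi =
  let (v , pv , Σv≡) = split-sum n lo≤hi (*-monoʳ-≤ n lo≤hi) ≤-refl
  in R ∸ n * hi ∷ v , (first-lower , first-upper) ∷ pv ,
     trans (cong (R ∸ n * hi +_) Σv≡) (m∸n+n≡m (m+n≤o⇒n≤o lo lo+n*hi≤R))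
  where
  lo+n*hi≤R : lo + n * hi ≤ R
  lo+n*hi≤R = <⇒≤ (≰⇒> R≰lo+n*hi)
  first-lower : lo ≤ R ∸ n * hi
  first-lower = m+n≤o⇒m≤o∸n lo lo+n*hi≤R
  first-upper : R ∸ n * hi ≤ hi
  first-upper = m≤n+o⇒m∸n≤o R (n * hi) (subst (R ≤_) (+-comm hi (n * hi)) upper)

module _ (m : ℕ) where

  private
    k K1 M : ℕ
    k  = suc (suc m)
    K1 = suc m
    M  = k * K1

  k≤M : k ≤ M
  k≤M = m≤m*n k K1

  *M+-%M : (q r : ℕ) → r < M → (q * M + r) % M ≡ r
  *M+-%M q r r<M = begin
    (q * M + r) % M ≡⟨ cong (_% M) (+-comm (q * M) r) ⟩
    (r + q * M) % M ≡⟨ [m+kn]%n≡m%n r q M ⟩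
    r % M           ≡⟨ m<n⇒m%n≡m r<M ⟩
    r               ∎
    where open ≡-Reasoning

  Oddoid-*M+ : (q : ℕ) {r : ℕ} → 1 ≤ r → r ≤ K1 → Oddoid k (q * M + r)
  Oddoid-*M+ q {r} 1≤r r≤K1 = ≤-trans 1≤r (m≤n+m r (q * M)) ,
                              subst (1 ≤_) (sym residue) 1≤r , subst (_≤ K1) (sym residue) r≤K1
    where
    residue : (q * M + r) % M ≡ r
    residue = *M+-%M q r (≤-trans (s≤s r≤K1) k≤M)

  ¬low-residue : {R : ℕ} → k ≤ R → R ≤ M → ¬ (1 ≤ R % M × R % M ≤ K1)
  ¬low-residue {R} k≤R R≤M (1≤R%M , R%M≤K1) with m≤n⇒m<n∨m≡n R≤M
  ... | inj₁ R<M = 1+n≰n (≤-trans k≤R (subst (_≤ K1) (m<n⇒m%n≡m R<M) R%M≤K1))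
  ... | inj₂ refl = 1+n≰n (subst (1 ≤_) (n%n≡0 M) 1≤R%M)

  Evenoid⇒*M+ : {y : ℕ} → Evenoid k y → Σ ℕ λ Q → Σ ℕ λ R → y ≡ Q * M + R × k ≤ R × R ≤ M
  Evenoid⇒*M+ {y} (0<y , ¬oddoid) =
    decompose (y % M) (y / M) (m≡m%n+[m/n]*n y M) (m%n<n y M) (λ low → ¬oddoid (0<y , low))
    where
    decompose : ∀ r q → y ≡ r + q * M → r < M → ¬ (1 ≤ r × r ≤ K1) →
                Σ ℕ λ Q → Σ ℕ λ R → y ≡ Q * M + R × k ≤ R × R ≤ M
    decompose zero    zero    y≡0 _ _ = ⊥-elim (<-irrefl (sym y≡0) 0<y)
    decompose zero    (suc q) y≡  _ _ = q , M , trans y≡ (+-comm M (q * M)) , k≤M , ≤-refl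
    decompose (suc r) q       y≡  r<M ¬low with suc r ≤? K1
    ... | yes r≤K1 = ⊥-elim (¬low (s≤s z≤n , r≤K1))
    ... | no  r≰K1 = q , suc r , trans y≡ (+-comm (suc r) (q * M)) , ≰⇒> r≰K1 , <⇒≤ r<M

  split-into-residues : (x : ℕ) → k ≤ x → x ≤ M →
                        Σ (Vec ℕ k) λ v → AllV (λ a → 1 ≤ a × a ≤ K1) v × sum v ≡ x
  split-into-residues x k≤x x≤M = split-sum k (s≤s z≤n) (subst (_≤ x) (sym (*-identityʳ k)) k≤x) x≤M

  sum-of-oddoids-¬oddoid : (n : ℕ) → Oddoid k n →
                           ¬ (Σ (Vec ℕ k) λ v → AllV (Oddoid k) v × sum v ≡ n)
  sum-of-oddoids-¬oddoid _ (_ , low-residue) (v , oddoids , refl) =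
    ¬low-residue k≤S (proj₂ bounds) (subst (λ r → 1 ≤ r × r ≤ K1) (sum-%-map M v) low-residue)
    where
    bounds : k * 1 ≤ sum (map (_% M) v) × sum (map (_% M) v) ≤ M
    bounds = sum-bounds (map (_% M) v) (AllV-map (_% M) v (All.map proj₂ oddoids))
    k≤S : k ≤ sum (map (_% M) v)
    k≤S = subst (_≤ sum (map (_% M) v)) (*-identityʳ k) (proj₁ bounds)

  SumOfOddoidsBelow : ℕ → ℕ → Set
  SumOfOddoidsBelow B y = Σ (Vec ℕ k) λ v → AllV (λ a → Oddoid k a × a < B) v × sum v ≡ y

  k*[P*M+k]≡[1+k*P]*M+k : (P : ℕ) → k * (P * M + k) ≡ (1 + k * P) * M + k
  k*[P*M+k]≡[1+k*P]*M+k = identity K1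
    where
    identity : ∀ b P → (1 + b) * (P * ((1 + b) * b) + (1 + b)) ≡ (1 + (1 + b) * P) * ((1 + b) * b) + (1 + b)
    identity = solve-∀

  k^[1+t]≡*M+k : (t : ℕ) → Σ ℕ λ P → k ^ suc t ≡ P * M + k
  k^[1+t]≡*M+k zero = 0 , *-identityʳ k
  k^[1+t]≡*M+k (suc t) with k^[1+t]≡*M+k t
  ... | P , k^[1+t]≡ = 1 + k * P , trans (cong (k *_) k^[1+t]≡) (k*[P*M+k]≡[1+k*P]*M+k P)

  quotient-bound : (P Q R : ℕ) → k ≤ R → Q * M + R < k * (P * M + k) → Q ≤ k * P
  quotient-bound P Q R k≤R y<bound =
    s≤s⁻¹ (*-cancelʳ-< M Q (1 + k * P) (+-cancelʳ-< k (Q * M) ((1 + k * P) * M) Q*M+k<))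
    where
    Q*M+k< : Q * M + k < (1 + k * P) * M + k
    Q*M+k< = subst (Q * M + k <_) (k*[P*M+k]≡[1+k*P]*M+k P) (≤-<-trans (+-monoʳ-≤ (Q * M) k≤R) y<bound)

  sum-of-oddoids-below : (P : ℕ) {Q R : ℕ} → Q ≤ k * P → k ≤ R → R ≤ M →
                         SumOfOddoidsBelow (P * M + k) (Q * M + R)
  sum-of-oddoids-below P {Q} {R} Q≤k*P k≤R R≤M
    with split-sum k {0} {P} z≤n (subst (_≤ Q) (sym (*-zeroʳ k)) z≤n) Q≤k*P
       | split-into-residues R k≤R R≤M
  ... | qs , qs-bounded , Σqs≡ | rs , rs-bounded , Σrs≡ =
    zipWith (λ q r → q * M + r) qs rs ,
    AllV-zipWith (λ q r → q * M + r) summand qs rs qs-bounded rs-bounded ,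
    trans (sum-zipWith-*+ M qs rs) (cong₂ (λ a b → a * M + b) Σqs≡ Σrs≡)
    where
    summand : ∀ {q r} → 0 ≤ q × q ≤ P → 1 ≤ r × r ≤ K1 → Oddoid k (q * M + r) × q * M + r < P * M + k
    summand {q} (_ , q≤P) (1≤r , r≤K1) = Oddoid-*M+ q 1≤r r≤K1 , +-mono-≤-< (*-monoˡ-≤ M q≤P) (s≤s r≤K1)

  evenoid-sum-of-oddoids : (s : ℕ) → 0 < s → (y : ℕ) → Evenoid k y → y < k ^ s →
                           SumOfOddoidsBelow (k ^ (s ∸ 1)) y
  evenoid-sum-of-oddoids (suc zero) _ y evenoid y<k with Evenoid⇒*M+ evenoid
  ... | Q , R , refl , k≤R , _ =
    ⊥-elim (<⇒≱ (subst (Q * M + R <_) (*-identityʳ k) y<k) (≤-trans k≤R (m≤n+m R (Q * M))))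
  evenoid-sum-of-oddoids (suc (suc t)) _ y evenoid y<k^s with Evenoid⇒*M+ evenoid | k^[1+t]≡*M+k t
  ... | Q , R , refl , k≤R , R≤M | P , k^[1+t]≡ =
    subst (λ B → SumOfOddoidsBelow B (Q * M + R)) (sym k^[1+t]≡)
      (sum-of-oddoids-below P (quotient-bound P Q R k≤R y<bound) k≤R R≤M)
    where
    y<bound : Q * M + R < k * (P * M + k)
    y<bound = subst (λ B → Q * M + R < k * B) k^[1+t]≡ y<k^s

lemma5p5 : (m : ℕ) → let k = suc (suc m) in
    ((n : ℕ) → Oddoid k n → ¬ (Σ (Vec ℕ k) λ v → AllV (Oddoid k) v × sum v ≡ n))
    × ((x : ℕ) → k ≤ x → x ≤ k * (k ∸ 1) →
        Σ (Vec ℕ k) λ v → AllV (λ a → 1 ≤ a × a ≤ k ∸ 1) v × sum v ≡ x)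
    × ((s : ℕ) → 0 < s → (y : ℕ) → Evenoid k y → y < k ^ s →
        Σ (Vec ℕ k) λ v → AllV (λ a → Oddoid k a × a < k ^ (s ∸ 1)) v × sum v ≡ y)
lemma5p5 m =
  sum-of-oddoids-¬oddoid m ,
  split-into-residues m ,
  evenoid-sum-of-oddoids m
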